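{- If $\Gamma$ is a finite, incomplete, connected graph with property R, then $\Gamma$ contains at most one branch point (vertex of valency at least 3).
   Context: For a set $P$ with a symmetric reflexive relation $\mathcal{C}$: a labelled heap is $(E,\le,\varepsilon)$ with $(E,\le)$ a finite poset, $\varepsilon:E\to P$, such that elements with $\varepsilon(a)\,\mathcal{C}\,\varepsilon(b)$ are comparable and $\le$ is the transitive closure of "$a\le b$ and $\varepsilon(a)\,\mathcal{C}\,\varepsilon(b)$"; heaps are label-preserving isomorphism classes, forming $H(P,\mathcal{C})$. $E(v)$ is the subheap on $E\setminus\{v\}$ (order: transitive closure of the same relation restricted). Trivial heap: trivial order. Convex chain: chain $x_1<\dots<x_t$ containing every $y$ with $x_i<y<x_j$; length $t$; balanced if $\varepsilon(x_1)=\varepsilon(x_t)$. Property P2: no balanced convex chain of length 2 or 3. $E(a)\prec^+E$ if $a$ is maximal in $E$ and some element maximal in $E(a)$ but not in $E$ has label $\ne\varepsilon(a)$; $\prec^-$ likewise with minimal elements; $\prec$ means either. Property P1: there is a (possibly trivial) sequence $E_1\prec\cdots\prec E$ with $E_1$ trivial. The concurrency graph of $H(P,\mathcal{C})$ has vertices $P$ and edges between distinct $v,w$ with $v\,\mathcal{C}\,w$. A graph has property R if it is the concurrency graph of a class of heaps in which every heap with property P2 has property P1. -}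

module Defs where

open import Data.Nat using (ℕ; zero; suc; _≤_)
open import Data.Fin using (Fin; zero; suc; punchIn; fromℕ) renaming (_<_ to _<ᶠ_)
open import Data.Fin.Subset using (Subset; ∣_∣)
open import Data.Vec using (tabulate)
open import Data.Bool using (Bool; true; false)
open import Data.Product using (Σ; ∃; ∃-syntax; _×_; _,_)
open import Data.Sum using (_⊎_)
open import Relation.Nullary using (¬_)
open import Relation.Binary.PropositionalEquality using (_≡_; _≢_)
open import Relation.Binary.Structures using (IsPartialOrder)
open import Relation.Binary.Construct.Closure.ReflexiveTransitive using (Star)

record Graph (n : ℕ) : Set where
  field
    adj    : Fin n → Fin n → Bool
    sym    : ∀ u v → adj u v ≡ adj v u
    irrefl : ∀ v → adj v v ≡ false
open Graph public

Adj : ∀ {n} → Graph n → Fin n → Fin n → Set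
Adj Γ u v = adj Γ u v ≡ true

Connected : ∀ {n} → Graph n → Set
Connected Γ = ∀ u v → Star (Adj Γ) u v

Incomplete : ∀ {n} → Graph n → Set
Incomplete Γ = ∃[ u ] ∃[ v ] (u ≢ v × adj Γ u v ≡ false)

valency : ∀ {n} → Graph n → Fin n → ℕ
valency Γ v = ∣ tabulate (adj Γ v) ∣

BranchPoint : ∀ {n} → Graph n → Fin n → Set
BranchPoint Γ v = 3 ≤ valency Γ v

-- The symmetric reflexive relation C on P = Fin n whose concurrency
-- graph is Γ:  v C w  iff  v = w or v, w adjacent in Γ.

Conc : ∀ {n} → Graph n → Fin n → Fin n → Set
Conc Γ v w = v ≡ w ⊎ Adj Γ v w

record Raw (n m : ℕ) : Set₁ where
  field
    lab : Fin m → Fin n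
    _≼_ : Fin m → Fin m → Set
open Raw public

Gen : ∀ {n m} → Graph n → Raw n m → Fin m → Fin m → Set
Gen Γ E a b = _≼_ E a b × Conc Γ (lab E a) (lab E b)

record IsHeap {n m} (Γ : Graph n) (E : Raw n m) : Set where
  field
    isPartialOrder : IsPartialOrder _≡_ (_≼_ E)
    comparable     : ∀ a b → Conc Γ (lab E a) (lab E b) → _≼_ E a b ⊎ _≼_ E b a
    generated      : ∀ a b → _≼_ E a b → Star (Gen Γ E) a b

-- E(v): the subheap on E \ {v}, with order the (reflexive-)transitive
-- closure of the generating relation restricted to E \ {v}
del : ∀ {n m} → Graph n → Raw n (suc m) → Fin (suc m) → Raw n m
del Γ E v = record
  { lab = λ x → lab E (punchIn v x)
  ; _≼_ = Star (λ x y → Gen Γ E (punchIn v x) (punchIn v y))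
  }

Trivial : ∀ {n m} → Raw n m → Set
Trivial E = ∀ a b → _≼_ E a b → a ≡ b

Maximal : ∀ {n m} → Raw n m → Fin m → Set
Maximal E a = ∀ b → _≼_ E a b → b ≡ a

Minimal : ∀ {n m} → Raw n m → Fin m → Set
Minimal E a = ∀ b → _≼_ E b a → b ≡ a

Prec⁺ : ∀ {n m} → Graph n → Raw n (suc m) → Fin (suc m) → Set
Prec⁺ Γ E a = Maximal E a × ∃[ b ] (Maximal (del Γ E a) b × ¬ Maximal E (punchIn a b)
                                     × lab E (punchIn a b) ≢ lab E a)

Prec⁻ : ∀ {n m} → Graph n → Raw n (suc m) → Fin (suc m) → Set
Prec⁻ Γ E a = Minimal E a × ∃[ b ] (Minimal (del Γ E a) b × ¬ Minimal E (punchIn a b)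
                                     × lab E (punchIn a b) ≢ lab E a)

Prec : ∀ {n m} → Graph n → Raw n (suc m) → Fin (suc m) → Set
Prec Γ E a = Prec⁺ Γ E a ⊎ Prec⁻ Γ E a

-- P1: a sequence E₁ ≺ E₂ ≺ ⋯ ≺ E with E₁ trivial
data P1 {n} (Γ : Graph n) : ∀ {m} → Raw n m → Set₁ where
  base : ∀ {m} {E : Raw n m} → Trivial E → P1 Γ E
  step : ∀ {m} {E : Raw n (suc m)} (a : Fin (suc m)) →
         Prec Γ E a → P1 Γ (del Γ E a) → P1 Γ E

-- convex chain x₀ < x₁ < ⋯ < x_k of length k+1
Strict : ∀ {n m} → Raw n m → Fin m → Fin m → Set
Strict E a b = _≼_ E a b × a ≢ b

record ConvexChain {n m} (E : Raw n m) (k : ℕ) (x : Fin (suc k) → Fin m) : Set where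
  field
    chain  : ∀ i j → i <ᶠ j → Strict E (x i) (x j)
    convex : ∀ i j y → Strict E (x i) y → Strict E y (x j) → ∃[ l ] x l ≡ y

Balanced : ∀ {n m} → Raw n m → (k : ℕ) → (Fin (suc k) → Fin m) → Set
Balanced E k x = lab E (x zero) ≡ lab E (x (fromℕ k))

P2 : ∀ {n m} → Raw n m → Set
P2 {m = m} E = ∀ k (x : Fin (suc k) → Fin m) → ConvexChain E k x →
               (k ≡ 1 ⊎ k ≡ 2) → ¬ Balanced E k x

-- property R: Γ is the concurrency graph of H(Fin n, C_Γ), and in that
-- class every heap with P2 has P1
PropertyR : ∀ {n} → Graph n → Set₁
PropertyR {n} Γ = ∀ m (E : Raw n m) → IsHeap Γ E → P2 E → P1 Γ E

AtMostOneBranchPoint : ∀ {n} → Graph n → Set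
AtMostOneBranchPoint Γ = ∀ u v → BranchPoint Γ u → BranchPoint Γ v → u ≡ v

module Submission where

-- A cherry at c avoiding p is a pair of non-adjacent neighbours of c, both different from p.
-- If Γ has two branch points, it has a non-backtracking walk w₀ … wₖ (k ≥ 1) with a cherry at
-- w₀ avoiding w₁ and one at wₖ avoiding wₖ₋₁: join the branch points by a non-backtracking walk
-- and make each end carry such a cherry, either as it is or after a detour around a triangle at
-- that end.  Where this fails, a suitable edge or triangle is found directly; when the closed
-- neighbourhood of the branch point is a clique, the triangle uses an edge leaving it, which
-- exists since Γ is connected and incomplete.  Such a walk is turned into a heap whose order is
-- the level order: the two cherry vertices at w₀ on level 0, wᵢ on level i + 1, the two at wₖ on
-- level k + 2.  Labels on consecutive levels are adjacent and labels two levels apart differ, so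
-- equal labels are at least three levels apart, which rules out balanced convex chains of length
-- 2 or 3.  Yet no extremal element a can be removed as P1 demands: a has a twin on its level,
-- and every element of E(a) that is not extremal in E still reaches that twin inside E(a).

open import Data.Bool using (true; false)
import Data.Bool as Bool
open import Data.Bool.Properties using (not-¬; ¬-not)
open import Data.Empty using (⊥-elim)
open import Data.Fin using (Fin; zero; suc; toℕ; fromℕ<; punchIn; punchOut)
open import Data.Fin.Properties
  using (_≟_; any?; toℕ-injective; toℕ<n; toℕ-fromℕ<; punchIn-punchOut)
open import Data.Fin.Subset using (Subset; ∣_∣; _∈_; _∉_; _-_; Nonempty; inside; outside)
open import Data.Fin.Subset.Properties using (p─⊥≡p; p─q⊆p; nonempty?; Empty-unique; ∣⊥∣≡0)
open import Data.Nat using (ℕ; zero; suc; _+_; _∸_; _≤_; _<_; z≤n; s≤s)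
open import Data.Nat.Properties
  using ( ≤-refl; ≤-reflexive; ≤-trans; ≤-pred; ≤-antisym; <-trans; <-irrefl; <⇒≤; <⇒≱; <-cmp
        ; n≤1+n; m≤n+m; ≮⇒≥; n≤0⇒n≡0; ≤∧≢⇒<; m≤n⇒m<n∨m≡n; m≤n⇒∃[o]m+o≡n; 1+n≢n
        ; suc-injective; +-suc; +-comm; +-∸-assoc; m∸n≤m; n∸n≡0; m+n∸n≡m )
open import Data.Product using (∃-syntax; Σ-syntax; _×_; _,_; proj₂)
open import Data.Sum using (_⊎_; inj₁; inj₂)
open import Data.Vec using (_∷_; tabulate; there)
open import Data.Vec.Properties using (lookup∘tabulate; []=⇒lookup)
open import Function using (_∘_)
open import Relation.Binary.Construct.Closure.ReflexiveTransitive using (Star; ε; _◅_)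
  renaming (map to Star-map)
import Relation.Binary.Construct.StrictToNonStrict as StrictToNonStrict
open import Relation.Binary.Definitions using (tri<; tri≈; tri>)
open import Relation.Binary.PropositionalEquality
  using (_≡_; _≢_; refl; sym; trans; cong; subst; subst₂; isEquivalence; resp₂)
open import Relation.Binary.Structures using (IsStrictPartialOrder)
open import Relation.Nullary using (¬_; Dec; yes; no)
open import Relation.Nullary.Decidable using (decidable-stable; _×-dec_; _⊎-dec_; ¬?)
open import Relation.Unary using (Decidable)
open import Defs hiding (sym)

∣p∣≤suc∣p-x∣ : ∀ {n} (p : Subset n) x → ∣ p ∣ ≤ suc ∣ p - x ∣
∣p∣≤suc∣p-x∣ (inside  ∷ p) zero    = s≤s (≤-reflexive (cong ∣_∣ (sym (p─⊥≡p p))))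
∣p∣≤suc∣p-x∣ (outside ∷ p) zero    =
  ≤-trans (≤-reflexive (cong ∣_∣ (sym (p─⊥≡p p)))) (n≤1+n _)
∣p∣≤suc∣p-x∣ (inside  ∷ p) (suc x) = s≤s (∣p∣≤suc∣p-x∣ p x)
∣p∣≤suc∣p-x∣ (outside ∷ p) (suc x) = ∣p∣≤suc∣p-x∣ p x

x∉p-x : ∀ {n} (p : Subset n) x → x ∉ p - x
x∉p-x (_ ∷ p) (suc x) (there x∈p-x) = x∉p-x p x x∈p-x

x∈p-y⇒x≢y : ∀ {n} {p : Subset n} {x y} → x ∈ p - y → x ≢ y
x∈p-y⇒x≢y {p = p} x∈p-x refl = x∉p-x p _ x∈p-x

0<∣p∣⇒nonempty : ∀ {n} (p : Subset n) → 0 < ∣ p ∣ → Nonempty p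
0<∣p∣⇒nonempty {n} p 0<∣p∣ with nonempty? p
... | yes p≢∅ = p≢∅
... | no  p≡∅ = ⊥-elim (<-irrefl (sym (trans (cong ∣_∣ (Empty-unique p≡∅)) (∣⊥∣≡0 n))) 0<∣p∣)

∈-avoiding : ∀ {n} (p : Subset n) y z → 3 ≤ ∣ p ∣ → ∃[ c ] (c ∈ p × c ≢ y × c ≢ z)
∈-avoiding p y z 3≤∣p∣
  with 0<∣p∣⇒nonempty (p - y - z) (≤-pred (≤-pred (≤-trans 3≤∣p∣
         (≤-trans (∣p∣≤suc∣p-x∣ p y) (s≤s (∣p∣≤suc∣p-x∣ (p - y) z))))))
... | c , c∈p-y-z = c , p─q⊆p p _ c∈p-y , x∈p-y⇒x≢y c∈p-y , x∈p-y⇒x≢y c∈p-y-z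
  where
  c∈p-y : c ∈ p - y
  c∈p-y = p─q⊆p (p - y) _ c∈p-y-z

Star-exit : ∀ {A : Set} {R : A → A → Set} {P : A → Set} → Decidable P →
            ∀ {x y} → Star R x y → P x → ¬ P y → ∃[ s ] ∃[ t ] (P s × ¬ P t × R s t)
Star-exit P? ε Px ¬Py = ⊥-elim (¬Py Px)
Star-exit P? {x} (_◅_ {j = z} x~z path) Px ¬Py with P? z
... | yes Pz  = Star-exit P? path Pz ¬Py
... | no  ¬Pz = x , z , Px , ¬Pz , x~z

m∸n≡suc[m∸suc[n]] : ∀ {m n} → n < m → m ∸ n ≡ suc (m ∸ suc n)
m∸n≡suc[m∸suc[n]] (s≤s n≤m) = +-∸-assoc 1 n≤m

neighbours : ∀ {n} → Graph n → Fin n → Subset n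
neighbours Γ u = tabulate (adj Γ u)

module GraphFacts {n} (Γ : Graph n) where

  Adj? : ∀ u v → Dec (Adj Γ u v)
  Adj? u v = adj Γ u v Bool.≟ true

  Adj-sym : ∀ {u v} → Adj Γ u v → Adj Γ v u
  Adj-sym {u} {v} u~v = trans (Graph.sym Γ v u) u~v

  Adj⇒≢ : ∀ {u v} → Adj Γ u v → u ≢ v
  Adj⇒≢ {u} u~u refl = not-¬ (irrefl Γ u) u~u

  Conc-sym : ∀ {u v} → Conc Γ u v → Conc Γ v u
  Conc-sym (inj₁ u≡v) = inj₁ (sym u≡v)
  Conc-sym (inj₂ u~v) = inj₂ (Adj-sym u~v)

  nonadjacent⇒¬Conc : ∀ {u v} → u ≢ v → adj Γ u v ≡ false → ¬ Conc Γ u v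
  nonadjacent⇒¬Conc u≢v _   (inj₁ u≡v) = u≢v u≡v
  nonadjacent⇒¬Conc _   u≁v (inj₂ u~v) = not-¬ u≁v u~v

  neighbour-avoiding : ∀ {u} → BranchPoint Γ u → ∀ y z → ∃[ c ] (Adj Γ u c × c ≢ y × c ≢ z)
  neighbour-avoiding {u} branch y z with ∈-avoiding (neighbours Γ u) y z branch
  ... | c , c∈N[u] , c≢y , c≢z =
    c , trans (sym (lookup∘tabulate (adj Γ u) c)) ([]=⇒lookup c∈N[u]) , c≢y , c≢z

module _ {n m} {E : Raw n m} where

  convexChain₁-gapless : ∀ {x y} → ConvexChain E 1 x →
                         Strict E (x zero) y → ¬ Strict E y (x (suc zero))
  convexChain₁-gapless chain x₀<y y<x₁ with ConvexChain.convex chain zero (suc zero) _ x₀<y y<x₁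
  ... | zero     , refl = proj₂ x₀<y refl
  ... | suc zero , refl = proj₂ y<x₁ refl

  convexChain₂-middle : ∀ {x y} → ConvexChain E 2 x →
                        Strict E (x zero) y → Strict E y (x (suc (suc zero))) → x (suc zero) ≡ y
  convexChain₂-middle chain x₀<y y<x₂ with ConvexChain.convex chain zero (suc (suc zero)) _ x₀<y y<x₂
  ... | zero           , refl = ⊥-elim (proj₂ x₀<y refl)
  ... | suc zero       , x₁≡y = x₁≡y
  ... | suc (suc zero) , refl = ⊥-elim (proj₂ y<x₂ refl)

module Ascent {n m} (Γ : Graph n) (lab : Fin m → Fin n) (lvl : Fin m → ℕ)
  (layers-adjacent : ∀ a b → lvl b ≡ suc (lvl a) → Adj Γ (lab a) (lab b)) where

  Up : Fin m → Fin m → Set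
  Up a b = lvl a < lvl b × Adj Γ (lab a) (lab b)

  LayersBetween : Fin m → Fin m → Set
  LayersBetween a b = ∀ l → lvl a < l → l < lvl b → ∃[ c ] lvl c ≡ l

  climb : ∀ o {a b} → lvl b ≡ suc (o + lvl a) → LayersBetween a b → Star Up a b
  climb zero    {a} {b} b≡ _ = (≤-reflexive (sym b≡) , layers-adjacent a b b≡) ◅ ε
  climb (suc o) {a} {b} b≡ between
    with between (suc (lvl a)) ≤-refl (subst (suc (lvl a) <_) (sym b≡) (s≤s (s≤s (m≤n+m (lvl a) o))))
  ... | c , c≡ = (a<c , layers-adjacent a c c≡) ◅ climb o b≡′ (λ l c<l → between l (<-trans a<c c<l))
    where
    a<c : lvl a < lvl c
    a<c = ≤-reflexive (sym c≡)
    b≡′ : lvl b ≡ suc (o + lvl c)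
    b≡′ = trans b≡ (cong suc (trans (sym (+-suc o (lvl a))) (cong (o +_) (sym c≡))))

  ascend : ∀ {a b} → lvl a < lvl b → LayersBetween a b → Star Up a b
  ascend {a} a<b with m≤n⇒∃[o]m+o≡n a<b
  ... | o , a+1+o≡b = climb o (trans (sym a+1+o≡b) (cong suc (+-comm (lvl a) o)))

module Layered {n m} (Γ : Graph n) (lab : Fin (suc m) → Fin n) (lvl : Fin (suc m) → ℕ) (top : ℕ)
  (lvl≤top : ∀ a → lvl a ≤ top)
  (layer : ∀ l → l ≤ top → ∃[ a ] lvl a ≡ l)
  (layer-independent : ∀ a b → lvl a ≡ lvl b → Conc Γ (lab a) (lab b) → a ≡ b)
  (layers-adjacent : ∀ a b → lvl b ≡ suc (lvl a) → Adj Γ (lab a) (lab b))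
  (layers-two-apart : ∀ a b → lvl b ≡ 2 + lvl a → lab a ≢ lab b)
  where

  open GraphFacts Γ

  _<ₗ_ : Fin (suc m) → Fin (suc m) → Set
  a <ₗ b = lvl a < lvl b

  <ₗ-isStrictPartialOrder : IsStrictPartialOrder _≡_ _<ₗ_
  <ₗ-isStrictPartialOrder = record
    { isEquivalence = isEquivalence
    ; irrefl        = λ { refl → <-irrefl refl }
    ; trans         = <-trans
    ; <-resp-≈      = resp₂ _<ₗ_
    }

  open StrictToNonStrict _≡_ _<ₗ_ using (isPartialOrder) renaming (_≤_ to _⊑_)

  E : Raw n (suc m)
  E = record { lab = lab ; _≼_ = _⊑_ }

  open Ascent Γ lab lvl layers-adjacent using (Up; ascend)

  Up⇒Gen : ∀ {a b} → Up a b → Gen Γ E a b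
  Up⇒Gen (a<b , a~b) = inj₁ a<b , inj₂ a~b

  isHeap : IsHeap Γ E
  isHeap = record
    { isPartialOrder = isPartialOrder <ₗ-isStrictPartialOrder
    ; comparable     = comparable
    ; generated      = generated
    }
    where
    comparable : ∀ a b → Conc Γ (lab a) (lab b) → a ⊑ b ⊎ b ⊑ a
    comparable a b a≍b with <-cmp (lvl a) (lvl b)
    ... | tri< a<b _ _ = inj₁ (inj₁ a<b)
    ... | tri≈ _ a≡b _ = inj₁ (inj₂ (layer-independent a b a≡b a≍b))
    ... | tri> _ _ b<a = inj₂ (inj₁ b<a)

    generated : ∀ a b → a ⊑ b → Star (Gen Γ E) a b
    generated a b (inj₁ a<b)  =
      Star-map Up⇒Gen (ascend a<b λ l _ l<b → layer l (≤-trans (<⇒≤ l<b) (lvl≤top b)))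
    generated a b (inj₂ refl) = ε

  <⇒Strict : ∀ {a b} → lvl a < lvl b → Strict E a b
  <⇒Strict a<b = inj₁ a<b , λ { refl → <-irrefl refl a<b }

  Strict⇒< : ∀ {a b} → Strict E a b → lvl a < lvl b
  Strict⇒< (inj₁ a<b , _)   = a<b
  Strict⇒< (inj₂ a≡b , a≢b) = ⊥-elim (a≢b a≡b)

  balanced⇒three-apart : ∀ {a b} → Strict E a b → lab a ≡ lab b → 3 + lvl a ≤ lvl b
  balanced⇒three-apart {a} {b} a<b same-label =
    ≤∧≢⇒< (≤∧≢⇒< (Strict⇒< a<b) (λ b≡ → Adj⇒≢ (layers-adjacent a b (sym b≡)) same-label))
          (λ b≡ → layers-two-apart a b (sym b≡) same-label)

  strictly-between : ∀ {a b} l → lvl a < l → l < lvl b → ∃[ c ] (lvl c ≡ l × Strict E a c × Strict E c b)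
  strictly-between {b = b} l a<l l<b with layer l (≤-trans (<⇒≤ l<b) (lvl≤top b))
  ... | c , refl = c , refl , <⇒Strict a<l , <⇒Strict l<b

  hasP2 : P2 E
  hasP2 1 x chain (inj₁ refl) balanced =
    let far = balanced⇒three-apart (ConvexChain.chain chain zero (suc zero) (s≤s z≤n)) balanced
        (_ , _ , x₀<c , c<x₁) = strictly-between _ ≤-refl (≤-trans (n≤1+n _) far)
    in  convexChain₁-gapless chain x₀<c c<x₁
  hasP2 2 x chain (inj₂ refl) balanced =
    let far = balanced⇒three-apart (ConvexChain.chain chain zero (suc (suc zero)) (s≤s z≤n)) balanced
        (c , c≡ , x₀<c , c<x₂) = strictly-between _ ≤-refl (≤-trans (n≤1+n _) far)
        (d , d≡ , x₀<d , d<x₂) = strictly-between _ (n≤1+n _) far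
        c≡d = trans (sym (convexChain₂-middle chain x₀<c c<x₂)) (convexChain₂-middle chain x₀<d d<x₂)
    in  1+n≢n (sym (trans (sym c≡) (trans (cong lvl c≡d) d≡)))

  module WideEnds (0<top : 0 < top)
    (wide-bottom : ∀ a → lvl a ≡ 0 → ∃[ b ] (b ≢ a × lvl b ≡ 0))
    (wide-top : ∀ a → lvl a ≡ top → ∃[ b ] (b ≢ a × lvl b ≡ top))
    where

    top⇒maximal : ∀ {a} → lvl a ≡ top → Maximal E a
    top⇒maximal a-top b (inj₁ a<b) = ⊥-elim (<⇒≱ (subst (_< lvl b) a-top a<b) (lvl≤top b))
    top⇒maximal _     b (inj₂ a≡b) = sym a≡b

    bottom⇒minimal : ∀ {a} → lvl a ≡ 0 → Minimal E a
    bottom⇒minimal a-bottom b (inj₁ b<a) with subst (lvl b <_) a-bottom b<a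
    ... | ()
    bottom⇒minimal _ b (inj₂ b≡a) = b≡a

    maximal⇒top : ∀ {a} → Maximal E a → lvl a ≡ top
    maximal⇒top {a} a-max = ≤-antisym (lvl≤top a) (≮⇒≥ λ a<top →
      let (t , t-top) = layer top ≤-refl
          t≡a = a-max t (inj₁ (subst (lvl a <_) (sym t-top) a<top))
      in  <-irrefl (trans (cong lvl (sym t≡a)) t-top) a<top)

    minimal⇒bottom : ∀ {a} → Minimal E a → lvl a ≡ 0
    minimal⇒bottom {a} a-min = n≤0⇒n≡0 (≮⇒≥ λ 0<a →
      let (b , b-bottom) = layer 0 z≤n
          b≡a = a-min b (inj₁ (subst (_< lvl a) (sym b-bottom) 0<a))
      in  <-irrefl (trans (sym b-bottom) (cong lvl b≡a)) 0<a)

    ascend-without : ∀ v {x y} → lvl (punchIn v x) < lvl (punchIn v y) →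
                     (∀ l → lvl (punchIn v x) < l → l < lvl (punchIn v y) → l ≢ lvl v) →
                     _≼_ (del Γ E v) x y
    ascend-without v {x} {y} x<y avoids-v = Star-map Up⇒Gen (ascend-within x<y layers)
      where
      open Ascent Γ (lab ∘ punchIn v) (lvl ∘ punchIn v)
                  (λ a b → layers-adjacent (punchIn v a) (punchIn v b))
        using () renaming (ascend to ascend-within)

      layers : ∀ l → lvl (punchIn v x) < l → l < lvl (punchIn v y) → ∃[ c ] lvl (punchIn v c) ≡ l
      layers l x<l l<y with layer l (≤-trans (<⇒≤ l<y) (lvl≤top _))
      ... | c , refl = punchOut v≢c , cong lvl (punchIn-punchOut v≢c)
        where
        v≢c : v ≢ c
        v≢c refl = avoids-v _ x<l l<y refl

    lvl-punchOut : ∀ {v t} (v≢t : v ≢ t) → lvl (punchIn v (punchOut v≢t)) ≡ lvl t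
    lvl-punchOut v≢t = cong lvl (punchIn-punchOut v≢t)

    reaches-top : ∀ {v t} (v≢t : v ≢ t) → lvl v ≡ top → lvl t ≡ top →
                  ∀ {b} → lvl (punchIn v b) < top → _≼_ (del Γ E v) b (punchOut v≢t)
    reaches-top {v} v≢t v-top t-top b<top = ascend-without v (subst (_ <_) (sym t′-top) b<top)
      λ l _ l<t′ l≡v → <-irrefl (trans (trans l≡v v-top) (sym t′-top)) l<t′
      where
      t′-top : lvl (punchIn v (punchOut v≢t)) ≡ top
      t′-top = trans (lvl-punchOut v≢t) t-top

    reached-from-bottom : ∀ {v t} (v≢t : v ≢ t) → lvl v ≡ 0 → lvl t ≡ 0 →
                          ∀ {b} → 0 < lvl (punchIn v b) → _≼_ (del Γ E v) (punchOut v≢t) b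
    reached-from-bottom {v} v≢t v-bottom t-bottom {b} 0<b =
      ascend-without v (subst (_< lvl (punchIn v b)) (sym t′-bottom) 0<b)
        λ l t′<l _ l≡v → <-irrefl (trans t′-bottom (sym (trans l≡v v-bottom))) t′<l
      where
      t′-bottom : lvl (punchIn v (punchOut v≢t)) ≡ 0
      t′-bottom = trans (lvl-punchOut v≢t) t-bottom

    ¬Prec⁺ : ∀ a → ¬ Prec⁺ Γ E a
    ¬Prec⁺ a (a-max , b , b-max , b-not-max , _) with m≤n⇒m<n∨m≡n (lvl≤top (punchIn a b))
    ... | inj₂ b-top = b-not-max (top⇒maximal b-top)
    ... | inj₁ b<top with wide-top a (maximal⇒top a-max)
    ...   | t , t≢a , t-top = <-irrefl b-top b<top
      where
      a≢t : a ≢ t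
      a≢t = t≢a ∘ sym
      t′≡b : punchOut a≢t ≡ b
      t′≡b = b-max _ (reaches-top a≢t (maximal⇒top a-max) t-top b<top)
      b-top : lvl (punchIn a b) ≡ top
      b-top = trans (cong (lvl ∘ punchIn a) (sym t′≡b)) (trans (lvl-punchOut a≢t) t-top)

    ¬Prec⁻ : ∀ a → ¬ Prec⁻ Γ E a
    ¬Prec⁻ a (a-min , b , b-min , b-not-min , _) with m≤n⇒m<n∨m≡n (z≤n {lvl (punchIn a b)})
    ... | inj₂ 0≡b = b-not-min (bottom⇒minimal (sym 0≡b))
    ... | inj₁ 0<b with wide-bottom a (minimal⇒bottom a-min)
    ...   | t , t≢a , t-bottom = <-irrefl (sym b-bottom) 0<b
      where
      a≢t : a ≢ t
      a≢t = t≢a ∘ sym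
      t′≡b : punchOut a≢t ≡ b
      t′≡b = b-min _ (reached-from-bottom a≢t (minimal⇒bottom a-min) t-bottom 0<b)
      b-bottom : lvl (punchIn a b) ≡ 0
      b-bottom = trans (cong (lvl ∘ punchIn a) (sym t′≡b)) (trans (lvl-punchOut a≢t) t-bottom)

    ¬P1 : ¬ P1 Γ E
    ¬P1 (base trivial) =
      let (a , a-bottom) = layer 0 z≤n
          (b , b-top)    = layer top ≤-refl
          a≡b = trivial a b (inj₁ (subst₂ _<_ (sym a-bottom) (sym b-top) 0<top))
      in  <-irrefl (trans (sym a-bottom) (trans (cong lvl a≡b) b-top)) 0<top
    ¬P1 (step a (inj₁ removable⁺) _) = ¬Prec⁺ a removable⁺
    ¬P1 (step a (inj₂ removable⁻) _) = ¬Prec⁻ a removable⁻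

record NBWalk {n} (Γ : Graph n) (k : ℕ) : Set where
  field
    vertex       : ℕ → Fin n
    edge         : ∀ i → i < k → Adj Γ (vertex i) (vertex (suc i))
    no-backtrack : ∀ i → 2 + i ≤ k → vertex i ≢ vertex (2 + i)
open NBWalk

module _ {n} {Γ : Graph n} where
  open GraphFacts Γ

  point : Fin n → NBWalk Γ 0
  point u = record { vertex = λ _ → u ; edge = λ _ () ; no-backtrack = λ _ () }

  cons : ∀ {k} u (w : NBWalk Γ k) → Adj Γ u (vertex w 0) → (0 < k → u ≢ vertex w 1) →
         NBWalk Γ (suc k)
  cons {k} u w u~w₀ u≢w₁ = record { vertex = vertex′ ; edge = edge′ ; no-backtrack = no-backtrack′ }
    where
    vertex′ : ℕ → Fin n
    vertex′ zero    = u
    vertex′ (suc i) = vertex w i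

    edge′ : ∀ i → i < suc k → Adj Γ (vertex′ i) (vertex′ (suc i))
    edge′ zero    _         = u~w₀
    edge′ (suc i) (s≤s i<k) = edge w i i<k

    no-backtrack′ : ∀ i → 2 + i ≤ suc k → vertex′ i ≢ vertex′ (2 + i)
    no-backtrack′ zero    (s≤s 1≤k)   = u≢w₁ 1≤k
    no-backtrack′ (suc i) (s≤s 2+i≤k) = no-backtrack w i 2+i≤k

  tail : ∀ {k} → NBWalk Γ (suc k) → NBWalk Γ k
  tail w = record
    { vertex       = vertex w ∘ suc
    ; edge         = λ i i<k → edge w (suc i) (s≤s i<k)
    ; no-backtrack = λ i 2+i≤k → no-backtrack w (suc i) (s≤s 2+i≤k)
    }

  reverse : ∀ {k} → NBWalk Γ k → NBWalk Γ k
  reverse {k} w = record { vertex = λ i → vertex w (k ∸ i) ; edge = edge′ ; no-backtrack = no-backtrack′ }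
    where
    edge′ : ∀ i → i < k → Adj Γ (vertex w (k ∸ i)) (vertex w (k ∸ suc i))
    edge′ i i<k rewrite m∸n≡suc[m∸suc[n]] i<k =
      Adj-sym (edge w (k ∸ suc i) (subst (_≤ k) (m∸n≡suc[m∸suc[n]] i<k) (m∸n≤m k i)))

    no-backtrack′ : ∀ i → 2 + i ≤ k → vertex w (k ∸ i) ≢ vertex w (k ∸ (2 + i))
    no-backtrack′ i 2+i≤k same = no-backtrack w (k ∸ (2 + i)) (subst (_≤ k) k∸i≡ (m∸n≤m k i))
                                   (sym (trans (cong (vertex w) (sym k∸i≡)) same))
      where
      k∸i≡ : k ∸ i ≡ 2 + (k ∸ (2 + i))
      k∸i≡ = trans (m∸n≡suc[m∸suc[n]] (≤-trans (n≤1+n _) 2+i≤k))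
                   (cong suc (m∸n≡suc[m∸suc[n]] 2+i≤k))

  reverse-last : ∀ {k} (w : NBWalk Γ k) → vertex (reverse w) k ≡ vertex w 0
  reverse-last {k} w = cong (vertex w) (n∸n≡0 k)

  reverse-penultimate : ∀ {k} (w : NBWalk Γ (suc k)) → vertex (reverse w) k ≡ vertex w 1
  reverse-penultimate {k} w = cong (vertex w) (m+n∸n≡m 1 k)

  Star⇒NBWalk : ∀ {u v} → Star (Adj Γ) u v →
                ∃[ k ] Σ[ w ∈ NBWalk Γ k ] (vertex w 0 ≡ u × vertex w k ≡ v)
  Star⇒NBWalk {u} ε = 0 , point u , refl , refl
  Star⇒NBWalk {u} (u~w₀ ◅ path) with Star⇒NBWalk path
  ... | zero  , w , refl , w-end = 1 , cons u w u~w₀ (λ ()) , refl , w-end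
  ... | suc k , w , refl , w-end with vertex w 1 ≟ u
  ...   | yes w₁≡u = k , tail w , w₁≡u , w-end
  ...   | no  w₁≢u = 2 + k , cons u w u~w₀ (λ _ → w₁≢u ∘ sym) , refl , w-end

record Cherry {n} (Γ : Graph n) (c p : Fin n) : Set where
  constructor cherry
  field
    left right  : Fin n
    left-adj    : Adj Γ c left
    right-adj   : Adj Γ c right
    left≢right  : left ≢ right
    nonadjacent : adj Γ left right ≡ false
    left≢p      : left ≢ p
    right≢p     : right ≢ p
open Cherry

record CherryWalk {n} (Γ : Graph n) : Set where
  field
    {len} : ℕ
    walk  : NBWalk Γ (suc len)
    start : Cherry Γ (vertex walk 0) (vertex walk 1)
    end   : Cherry Γ (vertex walk (suc len)) (vertex walk len)

module CherryWalkHeap {n} {Γ : Graph n} (cw : CherryWalk Γ) where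
  open CherryWalk cw
  open GraphFacts Γ

  top : ℕ
  top = 3 + len

  pattern B₀  = zero
  pattern B₁  = suc zero
  pattern T₀  = suc (suc zero)
  pattern T₁  = suc (suc (suc zero))
  pattern W i = suc (suc (suc (suc i)))

  lvl : Fin (6 + len) → ℕ
  lvl B₀    = 0
  lvl B₁    = 0
  lvl T₀    = top
  lvl T₁    = top
  lvl (W i) = suc (toℕ i)

  label : Fin (6 + len) → Fin n
  label B₀    = left start
  label B₁    = right start
  label T₀    = left end
  label T₁    = right end
  label (W i) = vertex walk (toℕ i)

  W<top : ∀ i → lvl (W i) < top
  W<top i = s≤s (toℕ<n i)

  top≰W : ∀ i → ¬ top ≤ lvl (W i)
  top≰W i = <⇒≱ (W<top i)

  lvl≤top : ∀ a → lvl a ≤ top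
  lvl≤top B₀    = z≤n
  lvl≤top B₁    = z≤n
  lvl≤top T₀    = ≤-refl
  lvl≤top T₁    = ≤-refl
  lvl≤top (W i) = <⇒≤ (W<top i)

  layer : ∀ l → l ≤ top → ∃[ a ] lvl a ≡ l
  layer zero    _     = B₀ , refl
  layer (suc l) l<top with m≤n⇒m<n∨m≡n (≤-pred l<top)
  ... | inj₁ l<len+2 = W (fromℕ< l<len+2) , cong suc (toℕ-fromℕ< l<len+2)
  ... | inj₂ refl    = T₀ , refl

  cherry-¬Conc : ∀ {c p} (κ : Cherry Γ c p) → ¬ Conc Γ (left κ) (right κ)
  cherry-¬Conc κ = nonadjacent⇒¬Conc (left≢right κ) (nonadjacent κ)

  independent : ∀ a b → lvl a ≡ lvl b → Conc Γ (label a) (label b) → a ≡ b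
  independent B₀    B₀    _  _ = refl
  independent B₁    B₁    _  _ = refl
  independent T₀    T₀    _  _ = refl
  independent T₁    T₁    _  _ = refl
  independent B₀    T₀    () _
  independent B₀    T₁    () _
  independent B₀    (W _) () _
  independent B₁    T₀    () _
  independent B₁    T₁    () _
  independent B₁    (W _) () _
  independent B₀    B₁    _  c = ⊥-elim (cherry-¬Conc start c)
  independent B₁    B₀    _  c = ⊥-elim (cherry-¬Conc start (Conc-sym c))
  independent T₀    T₁    _  c = ⊥-elim (cherry-¬Conc end c)
  independent T₁    T₀    _  c = ⊥-elim (cherry-¬Conc end (Conc-sym c))
  independent (W i) (W j) e  _ = cong W (toℕ-injective (suc-injective e))
  independent T₀    (W i) e  _ = ⊥-elim (top≰W i (≤-reflexive e))
  independent T₁    (W i) e  _ = ⊥-elim (top≰W i (≤-reflexive e))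
  independent (W i) T₀    e  _ = ⊥-elim (top≰W i (≤-reflexive (sym e)))
  independent (W i) T₁    e  _ = ⊥-elim (top≰W i (≤-reflexive (sym e)))

  -- The level equations below are taken in the shape they have at the call sites, so that refl
  -- solves them.

  walk-edge : ∀ {l l′} → suc l′ ≡ suc (suc l) → l′ < 2 + len → Adj Γ (vertex walk l) (vertex walk l′)
  walk-edge refl l′<len+2 = edge walk _ (≤-pred l′<len+2)

  walk-end-adj : ∀ {l x} → top ≡ suc (suc l) → Adj Γ (vertex walk (suc len)) x → Adj Γ (vertex walk l) x
  walk-end-adj refl end~x = end~x

  walk-no-backtrack : ∀ {l l′} → suc l′ ≡ 3 + l → l′ < 2 + len → vertex walk l ≢ vertex walk l′
  walk-no-backtrack refl l′<len+2 = no-backtrack walk _ (≤-pred l′<len+2)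

  walk-penultimate-≢ : ∀ {l x} → top ≡ 3 + l → x ≢ vertex walk len → vertex walk l ≢ x
  walk-penultimate-≢ refl x≢ = x≢ ∘ sym

  adjacent : ∀ a b → lvl b ≡ suc (lvl a) → Adj Γ (label a) (label b)
  adjacent B₀    (W zero) _ = Adj-sym (left-adj start)
  adjacent B₁    (W zero) _ = Adj-sym (right-adj start)
  adjacent (W i) (W j)    e = walk-edge e (toℕ<n j)
  adjacent (W i) T₀       e = walk-end-adj e (left-adj end)
  adjacent (W i) T₁       e = walk-end-adj e (right-adj end)
  adjacent T₀    (W i)    e = ⊥-elim (top≰W i (≤-trans (n≤1+n top) (≤-reflexive (sym e))))
  adjacent T₁    (W i)    e = ⊥-elim (top≰W i (≤-trans (n≤1+n top) (≤-reflexive (sym e))))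

  two-apart : ∀ a b → lvl b ≡ 2 + lvl a → label a ≢ label b
  two-apart B₀    (W (suc zero)) _ = left≢p start
  two-apart B₁    (W (suc zero)) _ = right≢p start
  two-apart (W i) (W j)          e = walk-no-backtrack e (toℕ<n j)
  two-apart (W i) T₀             e = walk-penultimate-≢ e (left≢p end)
  two-apart (W i) T₁             e = walk-penultimate-≢ e (right≢p end)
  two-apart T₀    (W i)          e = ⊥-elim (top≰W i (≤-trans (m≤n+m top 2) (≤-reflexive (sym e))))
  two-apart T₁    (W i)          e = ⊥-elim (top≰W i (≤-trans (m≤n+m top 2) (≤-reflexive (sym e))))

  wide-bottom : ∀ a → lvl a ≡ 0 → ∃[ b ] (b ≢ a × lvl b ≡ 0)
  wide-bottom B₀    _  = B₁ , (λ ()) , refl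
  wide-bottom B₁    _  = B₀ , (λ ()) , refl
  wide-bottom T₀    ()
  wide-bottom T₁    ()
  wide-bottom (W _) ()

  wide-top : ∀ a → lvl a ≡ top → ∃[ b ] (b ≢ a × lvl b ≡ top)
  wide-top T₀    _ = T₁ , (λ ()) , refl
  wide-top T₁    _ = T₀ , (λ ()) , refl
  wide-top (W i) e = ⊥-elim (top≰W i (≤-reflexive (sym e)))

  open Layered Γ label lvl top lvl≤top layer independent adjacent two-apart public
  open WideEnds (s≤s z≤n) wide-bottom wide-top public

cherryWalk⇒¬R : ∀ {n} {Γ : Graph n} → CherryWalk Γ → ¬ PropertyR Γ
cherryWalk⇒¬R cw R = ¬P1 (R _ E isHeap hasP2)
  where open CherryWalkHeap cw

record CherryExtension {n} {Γ : Graph n} {k} (w : NBWalk Γ (suc k)) : Set where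
  field
    {len}            : ℕ
    walk             : NBWalk Γ (suc len)
    cherry-at-start  : Cherry Γ (vertex walk 0) (vertex walk 1)
    same-last        : vertex walk (suc len) ≡ vertex w (suc k)
    same-penultimate : vertex walk len ≡ vertex w k
open CherryExtension

module _ {n} {Γ : Graph n} where
  open GraphFacts Γ

  ClosedNbhd : Fin n → Fin n → Set
  ClosedNbhd u z = z ≡ u ⊎ Adj Γ u z

  CliqueNbhd : Fin n → Set
  CliqueNbhd u = ∀ {q c} → Adj Γ u q → Adj Γ u c → q ≢ c → Adj Γ q c

  nonadjacent-pair-or-clique : ∀ u →
    (∃[ q ] ∃[ c ] (Adj Γ u q × Adj Γ u c × q ≢ c × adj Γ q c ≡ false)) ⊎ CliqueNbhd u
  nonadjacent-pair-or-clique u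
    with any? (λ q → any? (λ c → Adj? u q ×-dec Adj? u c ×-dec ¬? (q ≟ c) ×-dec ¬? (Adj? q c)))
  ... | yes (q , c , u~q , u~c , q≢c , q≁c) = inj₁ (q , c , u~q , u~c , q≢c , ¬-not q≁c)
  ... | no none = inj₂ λ {q} {c} u~q u~c q≢c →
          decidable-stable (Adj? q c) λ q≁c → none (q , c , u~q , u~c , q≢c , q≁c)

  module _ {k} (w : NBWalk Γ (suc k)) where
    private
      u = vertex w 0
      p = vertex w 1

      u~p : Adj Γ u p
      u~p = edge w 0 (s≤s z≤n)

    keep-walk : ∀ {q c} → Adj Γ u q → Adj Γ u c → q ≢ c → adj Γ q c ≡ false → q ≢ p → c ≢ p →
                CherryExtension w
    keep-walk {q} {c} u~q u~c q≢c q≁c q≢p c≢p = record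
      { walk             = w
      ; cherry-at-start  = cherry q c u~q u~c q≢c q≁c q≢p c≢p
      ; same-last        = refl
      ; same-penultimate = refl
      }

    detour : BranchPoint Γ u → ∀ {q} → Adj Γ u q → q ≢ p → adj Γ q p ≡ false →
             CherryWalk Γ ⊎ CherryExtension w
    detour branch {q} u~q q≢p q≁p with neighbour-avoiding branch p q
    ... | c , u~c , c≢p , c≢q with adj Γ q c in q~c | adj Γ c p in c~p
    ...   | false | _     = inj₂ (keep-walk u~q u~c (c≢q ∘ sym) q~c q≢p c≢p)
    ...   | true  | true  = inj₁ record
      { walk  = cons u (point c) u~c (λ ())
      ; start = cherry q p u~q u~p q≢p q≁p (c≢q ∘ sym) (c≢p ∘ sym)
      ; end   = cherry q p (Adj-sym q~c) c~p q≢p q≁p (Adj⇒≢ u~q ∘ sym) (Adj⇒≢ u~p ∘ sym)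
      }
    ...   | true  | false = inj₂ record
      { walk             = cons u (cons q (cons c w (Adj-sym u~c) (λ _ → c≢p)) q~c (λ _ → Adj⇒≢ u~q ∘ sym))
                                u~q (λ _ → Adj⇒≢ u~c)
      ; cherry-at-start  = cherry c p u~c u~p c≢p c~p c≢q (q≢p ∘ sym)
      ; same-last        = refl
      ; same-penultimate = refl
      }

  module _ (connected : Connected Γ) (incomplete : Incomplete Γ) where

    clique⇒cherryWalk : ∀ {u} → BranchPoint Γ u → CliqueNbhd u → CherryWalk Γ
    clique⇒cherryWalk {u} branch clique =
      let (z , z∉N[u]) = outside-N[u] incomplete
          (t₀ , w₀ , t₀∈N[u] , w₀∉N[u] , t₀~w₀) = Star-exit N[u]? (connected u z) (inj₁ refl) z∉N[u]
      in  triangle (N[u]-exit t₀∈N[u] w₀∉N[u] t₀~w₀) w₀∉N[u] t₀~w₀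
      where
      N[u]? : Decidable (ClosedNbhd u)
      N[u]? z = (z ≟ u) ⊎-dec Adj? u z

      N[u]-clique : ∀ {a b} → ClosedNbhd u a → ClosedNbhd u b → a ≢ b → Adj Γ a b
      N[u]-clique (inj₁ refl) (inj₁ refl) a≢b = ⊥-elim (a≢b refl)
      N[u]-clique (inj₁ refl) (inj₂ u~b)  _   = u~b
      N[u]-clique (inj₂ u~a)  (inj₁ refl) _   = Adj-sym u~a
      N[u]-clique (inj₂ u~a)  (inj₂ u~b)  a≢b = clique u~a u~b a≢b

      outside-N[u] : Incomplete Γ → ∃[ z ] ¬ ClosedNbhd u z
      outside-N[u] (s , t , s≢t , s≁t) with N[u]? s | N[u]? t
      ... | no  s∉N[u] | _          = s , s∉N[u]
      ... | yes _      | no  t∉N[u] = t , t∉N[u]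
      ... | yes s∈N[u] | yes t∈N[u] = ⊥-elim (not-¬ s≁t (N[u]-clique s∈N[u] t∈N[u] s≢t))

      N[u]-exit : ∀ {t₀ w₀} → ClosedNbhd u t₀ → ¬ ClosedNbhd u w₀ → Adj Γ t₀ w₀ → Adj Γ u t₀
      N[u]-exit (inj₁ refl) w₀∉N[u] t₀~w₀ = ⊥-elim (w₀∉N[u] (inj₂ t₀~w₀))
      N[u]-exit (inj₂ u~t₀) _       _     = u~t₀

      triangle : ∀ {t₀ w₀} → Adj Γ u t₀ → ¬ ClosedNbhd u w₀ → Adj Γ t₀ w₀ → CherryWalk Γ
      triangle {t₀} {w₀} u~t₀ w₀∉N[u] t₀~w₀ =
        let (a , u~a , a≢t₀ , _)   = neighbour-avoiding branch t₀ t₀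
            (b , u~b , b≢t₀ , b≢a) = neighbour-avoiding branch t₀ a
            b-t₀   = cons b (point t₀) (clique u~b u~t₀ b≢t₀) (λ ())
            a-b-t₀ = cons a b-t₀ (clique u~a u~b (b≢a ∘ sym)) (λ _ → a≢t₀)
        in  record
          { walk  = cons t₀ a-b-t₀ (clique u~t₀ u~a (a≢t₀ ∘ sym)) (λ _ → b≢t₀ ∘ sym)
          ; start = cherry-avoiding u~a
          ; end   = cherry-avoiding u~b
          }
        where
        cherry-avoiding : ∀ {x} → Adj Γ u x → Cherry Γ t₀ x
        cherry-avoiding u~x = cherry u w₀ (Adj-sym u~t₀) t₀~w₀
          (λ u≡w₀ → w₀∉N[u] (inj₁ (sym u≡w₀))) (¬-not (w₀∉N[u] ∘ inj₂))
          (Adj⇒≢ u~x) (λ w₀≡x → w₀∉N[u] (inj₂ (subst (Adj Γ u) (sym w₀≡x) u~x)))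

    grow-cherry : ∀ {k} (w : NBWalk Γ (suc k)) → BranchPoint Γ (vertex w 0) →
                  CherryWalk Γ ⊎ CherryExtension w
    grow-cherry w branch with nonadjacent-pair-or-clique (vertex w 0)
    ... | inj₂ clique = inj₁ (clique⇒cherryWalk branch clique)
    ... | inj₁ (q , c , u~q , u~c , q≢c , q≁c) with q ≟ vertex w 1 | c ≟ vertex w 1
    ...   | yes refl | _        = detour w branch u~c (q≢c ∘ sym) (trans (Graph.sym Γ c q) q≁c)
    ...   | no  _    | yes refl = detour w branch u~q q≢c q≁c
    ...   | no  q≢p  | no  c≢p  = inj₂ (keep-walk w u~q u~c q≢c q≁c q≢p c≢p)

    two-branch-points⇒cherryWalk : ∀ {u v} → BranchPoint Γ u → BranchPoint Γ v → u ≢ v → CherryWalk Γ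
    two-branch-points⇒cherryWalk {u} {v} u-branch v-branch u≢v with Star⇒NBWalk (connected u v)
    ... | zero  , w , w-start , w-end = ⊥-elim (u≢v (trans (sym w-start) w-end))
    ... | suc _ , w , w-start , w-end with grow-cherry w (subst (BranchPoint Γ) (sym w-start) u-branch)
    ...   | inj₁ cw = cw
    ...   | inj₂ e₁ with grow-cherry (reverse (walk e₁))
                           (subst (BranchPoint Γ) (sym (trans (same-last e₁) w-end)) v-branch)
    ...     | inj₁ cw = cw
    ...     | inj₂ e₂ = record
      { walk  = walk e₂
      ; start = cherry-at-start e₂
      ; end   = subst₂ (Cherry Γ) (sym (trans (same-last e₂) (reverse-last (walk e₁))))
                                  (sym (trans (same-penultimate e₂) (reverse-penultimate (walk e₁))))
                                  (cherry-at-start e₁)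
      }

lemma3p3p6 : ∀ {n} (Γ : Graph n) → Connected Γ → Incomplete Γ → PropertyR Γ →
    AtMostOneBranchPoint Γ
lemma3p3p6 Γ connected incomplete R u v u-branch v-branch =
  decidable-stable (u ≟ v) λ u≢v →
    cherryWalk⇒¬R (two-branch-points⇒cherryWalk connected incomplete u-branch v-branch u≢v) R
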